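{- Let $E: y^2=x^3+Ax+B$ be an elliptic curve over a number field $K$, with non-trivial $2$-torsion points $P_i=(\alpha_i,0)$, $i=1,2,3$. Let $\phi: E^2\to\mathbb{P}^2$ be the map given for $P\neq O\neq Q$ by $\phi(P,Q)=[x(P)+x(Q):x(P)x(Q):1]$, extended to all of $E^2$ (so that $\phi(O,O)=[0:1:0]$). Then the curve $$\mathcal{C}_E : U^3 - 3UVW + AUW^2 + 2BW^3 = 0$$ in $\mathbb{P}^2$ (coordinates $[U:V:W]$) is the unique cubic curve with a double point at $\phi(O,O)$ passing through each of the points $\phi(P,Q)$ where $P$ and $Q$ are non-trivial $2$-torsion points on $E$ (i.e. the points $\phi(P_i,P_j)=[\alpha_i+\alpha_j:\alpha_i\alpha_j:1]$, $1\le i,j\le 3$).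
   Context: The map $\phi$ is the quotient map $E^2\to E^2/D_4\cong\mathbb{P}^2$ for the action of $D_4=\langle r,s\rangle$ on $E^2$ by $r(P,Q)=(-Q,P)$, $s(P,Q)=(P,-Q)$. -}

module Defs where

open import Level using (Level; _⊔_; suc)
open import Data.Nat using (ℕ)
import Data.Nat as ℕ
open import Data.Fin using (Fin)
open import Data.Product using (Σ; _×_; _,_; ∃)
open import Relation.Nullary using (¬_)
open import Relation.Binary.PropositionalEquality using (_≡_)
open import Algebra.Bundles using (CommutativeRing; Semiring)
import Algebra.Definitions.RawSemiring as RS

record Field (c ℓ : Level) : Set (suc (c ⊔ ℓ)) where
  field
    commutativeRing : CommutativeRing c ℓ
  open CommutativeRing commutativeRing public
  field
    1≉0     : ¬ (1# ≈ 0#)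
    inverse : ∀ x → ¬ (x ≈ 0#) → ∃ λ y → x * y ≈ 1#

module FieldTheory {c ℓ : Level} (K : Field c ℓ) where
  open Field K
  open RS (Semiring.rawSemiring semiring) using () renaming (_×_ to _·ℕ_)

  CharacteristicZero : Set ℓ
  CharacteristicZero = ∀ (n : ℕ) → ¬ ((ℕ.suc n ·ℕ 1#) ≈ 0#)

  2# 3# 6# : Carrier
  2# = 1# + 1#
  3# = 2# + 1#
  6# = 3# + 3#

  record Cubic : Set c where
    constructor cubic
    field
      cUUU cVVV cWWW cUUV cUUW cUVV cVVW cUWW cVWW cUVW : Carrier

  -- a point of K³ (representative of a point [u:v:w] of ℙ²)
  record Pt : Set c where
    constructor pt
    field u v w : Carrier

  module _ (F : Cubic) (p : Pt) where
    open Cubic F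
    open Pt p

    eval : Carrier
    eval = cUUU * (u * u * u) + cVVV * (v * v * v) + cWWW * (w * w * w)
         + cUUV * (u * u * v) + cUUW * (u * u * w) + cUVV * (u * v * v)
         + cVVW * (v * v * w) + cUWW * (u * w * w) + cVWW * (v * w * w)
         + cUVW * (u * v * w)

    ∂U ∂V ∂W : Carrier
    ∂U = 3# * cUUU * (u * u) + 2# * cUUV * (u * v) + 2# * cUUW * (u * w)
       + cUVV * (v * v) + cUWW * (w * w) + cUVW * (v * w)
    ∂V = cUUV * (u * u) + 2# * cUVV * (u * v) + 3# * cVVV * (v * v)
       + 2# * cVVW * (v * w) + cVWW * (w * w) + cUVW * (u * w)
    ∂W = cUUW * (u * u) + 2# * cUWW * (u * w) + cVVW * (v * v)
       + 2# * cVWW * (v * w) + 3# * cWWW * (w * w) + cUVW * (u * v)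

    ∂UU ∂VV ∂WW ∂UV ∂UW ∂VW : Carrier
    ∂UU = 6# * cUUU * u + 2# * cUUV * v + 2# * cUUW * w
    ∂VV = 2# * cUVV * u + 6# * cVVV * v + 2# * cVVW * w
    ∂WW = 2# * cUWW * u + 2# * cVWW * v + 6# * cWWW * w
    ∂UV = 2# * cUUV * u + 2# * cUVV * v + cUVW * w
    ∂UW = 2# * cUUW * u + cUVW * v + 2# * cUWW * w
    ∂VW = cUVW * u + 2# * cVVW * v + 2# * cVWW * w

    OnCurve : Set ℓ
    OnCurve = eval ≈ 0#

    -- p is a double point of F = 0: F and all first partials vanish at p
    -- (multiplicity ≥ 2), and some second partial does not (multiplicity exactly 2)
    IsDoublePoint : Set ℓ
    IsDoublePoint =
      eval ≈ 0# × ∂U ≈ 0# × ∂V ≈ 0# × ∂W ≈ 0#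
      × ¬ (∂UU ≈ 0# × ∂VV ≈ 0# × ∂WW ≈ 0# × ∂UV ≈ 0# × ∂UW ≈ 0# × ∂VW ≈ 0#)

  _≈_·_ : Cubic → Carrier → Cubic → Set ℓ
  F ≈ t · G =
      F.cUUU ≈ t * G.cUUU × F.cVVV ≈ t * G.cVVV × F.cWWW ≈ t * G.cWWW
    × F.cUUV ≈ t * G.cUUV × F.cUUW ≈ t * G.cUUW × F.cUVV ≈ t * G.cUVV
    × F.cVVW ≈ t * G.cVVW × F.cUWW ≈ t * G.cUWW × F.cVWW ≈ t * G.cVWW
    × F.cUVW ≈ t * G.cUVW
    where module F = Cubic F
          module G = Cubic G

  -- the curve C_E : U³ - 3UVW + AUW² + 2BW³ = 0
  C-E : Carrier → Carrier → Cubic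
  C-E A B = cubic 1# 0# (2# * B) 0# 0# 0# 0# A 0# (- 3#)

  φOO : Pt
  φOO = pt 0# 1# 0#

  -- φ(P,Q) = [x(P)+x(Q) : x(P)x(Q) : 1] for affine P, Q
  φ : Carrier → Carrier → Pt
  φ a b = pt (a + b) (a * b) 1#

  -- E : y² = x³ + Ax + B is an elliptic curve whose non-trivial 2-torsion
  -- points are (α i , 0): the α i are pairwise distinct roots of x³ + Ax + B
  Is2TorsionData : Carrier → Carrier → (Fin 3 → Carrier) → Set ℓ
  Is2TorsionData A B α =
    (∀ i → α i * α i * α i + A * α i + B ≈ 0#)
    × (∀ i j → ¬ (i ≡ j) → ¬ (α i ≈ α j))

-- Existence is a computation: C_E(φ(a,b)) = f(a) + f(b) for the Weierstrass
-- cubic f(x) = x³ + Ax + B, and C_E has tangent cone −3UW at [0:1:0].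
-- Uniqueness: a double point at [0:1:0] kills the coefficients of v³, uv², v²w
-- of F, leaving six coefficients δ of F − cUUU·C_E.  By Vieta's formulas
-- αᵢ + αⱼ = −αₖ and αᵢαⱼ = αₖ² + A, so modulo f(c) the conditions at the six
-- points φ(αᵢ,αᵢ) = [2c : c² : 1] and φ(αᵢ,αⱼ) = [−c : c² + A : 1] (c = αᵢ resp. αₖ)
-- become two quadratics in c with the three distinct roots αᵢ, hence zero.
-- Their six coefficients are linear in the δ, with determinant a multiple of
-- 2·3·(4A³ + 27B²), which is nonzero in characteristic 0 because the roots are
-- distinct.  So F = cUUU·C_E, and cUUU ≠ 0 since a zero cubic has no double point.
module Submission where

open import Defs
open import Level using (Level)
open import Data.Fin using (Fin; zero; suc)
open import Data.Product using (Σ; _×_; _,_; proj₁; proj₂)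
open import Relation.Nullary using (¬_; yes; no)
open import Data.Nat as ℕ using (ℕ; zero; suc)
open import Data.Integer as ℤ using (ℤ; +_; -[1+_])
import Data.Integer.Properties as ℤP
import Data.Nat.Properties as ℕP
open import Data.Sign as Sign using (Sign)
open import Data.Maybe using (Maybe; just; nothing)
import Relation.Binary.PropositionalEquality as PE
import Algebra.Solver.Ring.AlmostCommutativeRing as ACR
import Algebra.Solver.Ring
open import Algebra.Bundles using (CommutativeRing)

-- Every commutative ring R receives the canonical map ℤ → R, and it is a ring
-- homomorphism.  Instantiating the ring solver with it lets us verify
-- polynomial identities with integer coefficients in R.
module IntegerCoefficients {c ℓ : Level} (R : CommutativeRing c ℓ) where
  open CommutativeRing R
  open import Data.Integer using (_⊖_)
  open import Algebra.Properties.Ring ring using (-0#≈0#; -‿involutive; -‿distribˡ-*; -‿distribʳ-*; -‿+-comm)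
  open import Algebra.Properties.Semiring.Mult semiring using (×-homo-+; ×1-homo-*) renaming (_×_ to _·ₙ_)
  open import Algebra.Properties.CommutativeSemigroup +-commutativeSemigroup using (interchange)
  open import Relation.Binary.Reasoning.Setoid setoid

  -- The image of a natural number.  It is written so that nat 2 and nat 3 are
  -- literally 1# + 1# and (1# + 1#) + 1#, the numerals 2# and 3# of the field.
  nat : ℕ → Carrier
  nat zero = 0#
  nat (suc zero) = 1#
  nat (suc (suc n)) = nat (suc n) + 1#

  nat≈× : ∀ n → nat n ≈ n ·ₙ 1#
  nat≈× zero = refl
  nat≈× (suc zero) = sym (+-identityʳ 1#)
  nat≈× (suc (suc n)) = begin
    nat (suc n) + 1#    ≈⟨ +-comm _ _ ⟩
    1# + nat (suc n)    ≈⟨ +-congˡ (nat≈× (suc n)) ⟩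
    1# + suc n ·ₙ 1#     ∎

  nat-+ : ∀ m n → nat (m ℕ.+ n) ≈ nat m + nat n
  nat-+ m n = begin
    nat (m ℕ.+ n)       ≈⟨ nat≈× (m ℕ.+ n) ⟩
    (m ℕ.+ n) ·ₙ 1#      ≈⟨ ×-homo-+ 1# m n ⟩
    m ·ₙ 1# + n ·ₙ 1#     ≈⟨ +-cong (nat≈× m) (nat≈× n) ⟨
    nat m + nat n       ∎

  nat-* : ∀ m n → nat (m ℕ.* n) ≈ nat m * nat n
  nat-* m n = begin
    nat (m ℕ.* n)       ≈⟨ nat≈× (m ℕ.* n) ⟩
    (m ℕ.* n) ·ₙ 1#      ≈⟨ ×1-homo-* m n ⟩
    m ·ₙ 1# * (n ·ₙ 1#)   ≈⟨ *-cong (nat≈× m) (nat≈× n) ⟨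
    nat m * nat n       ∎

  ⟦_⟧ℤ : ℤ → Carrier
  ⟦ + n ⟧ℤ = nat n
  ⟦ -[1+ n ] ⟧ℤ = - nat (suc n)

  ⊖-hom : ∀ m n → ⟦ m ⊖ n ⟧ℤ ≈ nat m - nat n
  ⊖-hom m zero = begin
    ⟦ m ⊖ 0 ⟧ℤ    ≈⟨ reflexive (PE.cong ⟦_⟧ℤ (ℤP.⊖-≥ {m} {0} ℕ.z≤n)) ⟩
    nat m         ≈⟨ +-identityʳ (nat m) ⟨
    nat m + 0#    ≈⟨ +-congˡ -0#≈0# ⟨
    nat m - 0#    ∎
  ⊖-hom zero (suc n) = begin
    ⟦ 0 ⊖ suc n ⟧ℤ    ≈⟨ reflexive (PE.cong ⟦_⟧ℤ (ℤP.⊖-< {0} {suc n} (ℕ.s≤s ℕ.z≤n))) ⟩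
    - nat (suc n)     ≈⟨ +-identityˡ _ ⟨
    0# - nat (suc n)  ∎
  ⊖-hom (suc m) (suc n) = begin
    ⟦ suc m ⊖ suc n ⟧ℤ            ≈⟨ reflexive (PE.cong ⟦_⟧ℤ (ℤP.[1+m]⊖[1+n]≡m⊖n m n)) ⟩
    ⟦ m ⊖ n ⟧ℤ                    ≈⟨ ⊖-hom m n ⟩
    nat m - nat n                 ≈⟨ cancel-common-summand 1# (nat m) (nat n) ⟨
    (1# + nat m) - (1# + nat n)   ≈⟨ +-cong (nat-+ 1 m) (-‿cong (nat-+ 1 n)) ⟨
    nat (suc m) - nat (suc n)     ∎
    where
    cancel-common-summand : ∀ a x y → (a + x) - (a + y) ≈ x - y
    cancel-common-summand a x y = begin
      (a + x) - (a + y)       ≈⟨ +-congˡ (-‿+-comm a y) ⟨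
      (a + x) + (- a - y)     ≈⟨ interchange a x (- a) (- y) ⟩
      (a - a) + (x - y)       ≈⟨ +-congʳ (-‿inverseʳ a) ⟩
      0# + (x - y)            ≈⟨ +-identityˡ _ ⟩
      x - y                   ∎

  +-hom : ∀ i j → ⟦ i ℤ.+ j ⟧ℤ ≈ ⟦ i ⟧ℤ + ⟦ j ⟧ℤ
  +-hom (+ m) (+ n) = nat-+ m n
  +-hom (+ m) -[1+ n ] = ⊖-hom m (suc n)
  +-hom -[1+ m ] (+ n) = trans (⊖-hom n (suc m)) (+-comm _ _)
  +-hom -[1+ m ] -[1+ n ] = begin
    - nat (suc (suc (m ℕ.+ n)))     ≈⟨ -‿cong (reflexive (PE.cong nat (ℕP.+-suc (suc m) n))) ⟨
    - nat (suc m ℕ.+ suc n)         ≈⟨ -‿cong (nat-+ (suc m) (suc n)) ⟩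
    - (nat (suc m) + nat (suc n))   ≈⟨ -‿+-comm _ _ ⟨
    - nat (suc m) - nat (suc n)     ∎

  -- Multiplication is handled through the decomposition i = sign i ◃ ∣ i ∣.
  signed : Sign → Carrier → Carrier
  signed Sign.+ x = x
  signed Sign.- x = - x

  signed-cong : ∀ s {x y} → x ≈ y → signed s x ≈ signed s y
  signed-cong Sign.+ p = p
  signed-cong Sign.- p = -‿cong p

  signed-* : ∀ s t x y → signed (s Sign.* t) (x * y) ≈ signed s x * signed t y
  signed-* Sign.+ Sign.+ x y = refl
  signed-* Sign.+ Sign.- x y = -‿distribʳ-* x y
  signed-* Sign.- Sign.+ x y = -‿distribˡ-* x y
  signed-* Sign.- Sign.- x y = begin
    x * y           ≈⟨ -‿involutive _ ⟨
    - - (x * y)     ≈⟨ -‿cong (-‿distribˡ-* x y) ⟩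
    - (- x * y)     ≈⟨ -‿distribʳ-* (- x) y ⟩
    - x * - y       ∎

  ◃-hom : ∀ s n → ⟦ s ℤ.◃ n ⟧ℤ ≈ signed s (nat n)
  ◃-hom Sign.+ zero = refl
  ◃-hom Sign.- zero = sym -0#≈0#
  ◃-hom Sign.+ (suc n) = refl
  ◃-hom Sign.- (suc n) = refl

  sign-abs : ∀ i → ⟦ i ⟧ℤ ≈ signed (ℤ.sign i) (nat ℤ.∣ i ∣)
  sign-abs (+ n) = refl
  sign-abs -[1+ n ] = refl

  *-hom : ∀ i j → ⟦ i ℤ.* j ⟧ℤ ≈ ⟦ i ⟧ℤ * ⟦ j ⟧ℤ
  *-hom i j = begin
    ⟦ i ℤ.* j ⟧ℤ                                    ≈⟨ ◃-hom (s Sign.* t) (ℤ.∣ i ∣ ℕ.* ℤ.∣ j ∣) ⟩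
    signed (s Sign.* t) (nat (ℤ.∣ i ∣ ℕ.* ℤ.∣ j ∣))   ≈⟨ signed-cong (s Sign.* t) (nat-* ℤ.∣ i ∣ ℤ.∣ j ∣) ⟩
    signed (s Sign.* t) (nat ℤ.∣ i ∣ * nat ℤ.∣ j ∣)   ≈⟨ signed-* s t _ _ ⟩
    signed s (nat ℤ.∣ i ∣) * signed t (nat ℤ.∣ j ∣)   ≈⟨ *-cong (sign-abs i) (sign-abs j) ⟨
    ⟦ i ⟧ℤ * ⟦ j ⟧ℤ                                  ∎
    where s = ℤ.sign i ; t = ℤ.sign j

  neg-hom : ∀ i → ⟦ ℤ.- i ⟧ℤ ≈ - ⟦ i ⟧ℤ
  neg-hom (+ zero) = sym -0#≈0#
  neg-hom (+ suc n) = refl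
  neg-hom -[1+ n ] = sym (-‿involutive _)

  homomorphism : ACR._-Raw-AlmostCommutative⟶_ ℤ.+-*-rawRing (ACR.fromCommutativeRing R)
  homomorphism = record
    { ⟦_⟧ = ⟦_⟧ℤ ; +-homo = +-hom ; *-homo = *-hom ; -‿homo = neg-hom
    ; 0-homo = refl ; 1-homo = refl }

  coefficient-test : ∀ i j → Maybe (⟦ i ⟧ℤ ≈ ⟦ j ⟧ℤ)
  coefficient-test i j with i ℤP.≟ j
  ... | yes PE.refl = just refl
  ... | no _ = nothing

  open Algebra.Solver.Ring ℤ.+-*-rawRing (ACR.fromCommutativeRing R) homomorphism coefficient-test public

-- Each polynomial of the proof is written once over an arbitrary
-- RingSyntax and then read both in the field and in the solver's syntax of
-- polynomials, so that the identity checked by the solver is literally the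
-- identity used in the argument.
record RingSyntax {a} (X : Set a) : Set a where
  infixl 6 _⊕_
  infixl 7 _⊗_
  infix 8 ⊝_
  field
    _⊕_ _⊗_ : X → X → X
    ⊝_ : X → X
    num : ℕ → X

module Expressions {a} {X : Set a} (S : RingSyntax X) where
  open RingSyntax S public

  quadratic : X → X → X → X → X
  quadratic x y z c = x ⊗ (c ⊗ c) ⊕ y ⊗ c ⊕ z

  weierstrass : X → X → X → X
  weierstrass A B c = c ⊗ c ⊗ c ⊕ A ⊗ c ⊕ B

  -- 4A³ + 27B², minus the discriminant of x³ + Ax + B
  Δ : X → X → X
  Δ A B = num 4 ⊗ (A ⊗ A ⊗ A) ⊕ num 27 ⊗ (B ⊗ B)

  infixl 6 _⊖_
  _⊖_ : X → X → X
  x ⊖ y = x ⊕ ⊝ y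

  -- the ternary cubic form with the given coefficients and its first and
  -- second partial derivatives, written exactly as in Defs
  module Form (cUUU cVVV cWWW cUUV cUUW cUVV cVVW cUWW cVWW cUVW : X) where
    value dU dV dW dUU dVV dWW dUV dUW dVW : X → X → X → X
    value u v w = cUUU ⊗ (u ⊗ u ⊗ u) ⊕ cVVV ⊗ (v ⊗ v ⊗ v) ⊕ cWWW ⊗ (w ⊗ w ⊗ w)
      ⊕ cUUV ⊗ (u ⊗ u ⊗ v) ⊕ cUUW ⊗ (u ⊗ u ⊗ w) ⊕ cUVV ⊗ (u ⊗ v ⊗ v)
      ⊕ cVVW ⊗ (v ⊗ v ⊗ w) ⊕ cUWW ⊗ (u ⊗ w ⊗ w) ⊕ cVWW ⊗ (v ⊗ w ⊗ w)
      ⊕ cUVW ⊗ (u ⊗ v ⊗ w)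
    dU u v w = num 3 ⊗ cUUU ⊗ (u ⊗ u) ⊕ num 2 ⊗ cUUV ⊗ (u ⊗ v) ⊕ num 2 ⊗ cUUW ⊗ (u ⊗ w)
      ⊕ cUVV ⊗ (v ⊗ v) ⊕ cUWW ⊗ (w ⊗ w) ⊕ cUVW ⊗ (v ⊗ w)
    dV u v w = cUUV ⊗ (u ⊗ u) ⊕ num 2 ⊗ cUVV ⊗ (u ⊗ v) ⊕ num 3 ⊗ cVVV ⊗ (v ⊗ v)
      ⊕ num 2 ⊗ cVVW ⊗ (v ⊗ w) ⊕ cVWW ⊗ (w ⊗ w) ⊕ cUVW ⊗ (u ⊗ w)
    dW u v w = cUUW ⊗ (u ⊗ u) ⊕ num 2 ⊗ cUWW ⊗ (u ⊗ w) ⊕ cVVW ⊗ (v ⊗ v)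
      ⊕ num 2 ⊗ cVWW ⊗ (v ⊗ w) ⊕ num 3 ⊗ cWWW ⊗ (w ⊗ w) ⊕ cUVW ⊗ (u ⊗ v)
    dUU u v w = (num 3 ⊕ num 3) ⊗ cUUU ⊗ u ⊕ num 2 ⊗ cUUV ⊗ v ⊕ num 2 ⊗ cUUW ⊗ w
    dVV u v w = num 2 ⊗ cUVV ⊗ u ⊕ (num 3 ⊕ num 3) ⊗ cVVV ⊗ v ⊕ num 2 ⊗ cVVW ⊗ w
    dWW u v w = num 2 ⊗ cUWW ⊗ u ⊕ num 2 ⊗ cVWW ⊗ v ⊕ (num 3 ⊕ num 3) ⊗ cWWW ⊗ w
    dUV u v w = num 2 ⊗ cUUV ⊗ u ⊕ num 2 ⊗ cUVV ⊗ v ⊕ cUVW ⊗ w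
    dUW u v w = num 2 ⊗ cUUW ⊗ u ⊕ cUVW ⊗ v ⊕ num 2 ⊗ cUWW ⊗ w
    dVW u v w = cUVW ⊗ u ⊕ num 2 ⊗ cVVW ⊗ v ⊕ num 2 ⊗ cVWW ⊗ w

  -- For a
  -- root c of the Weierstrass cubic, F(2c, c², 1) and F(−c, c² + A, 1) are,
  -- up to a multiple of x³ + Ax + B and the three coefficients that a double
  -- point at [0:1:0] kills, quadratic polynomials in c.
  module Reduction (cUUU cVVV cWWW cUUV cUUW cUVV cVVW cUWW cVWW cUVW A B : X) where
    open Form cUUU cVVV cWWW cUUV cUUW cUVV cVVW cUWW cVWW cUVW public using (value)

    -- the remaining coefficients of F − cUUU · C_E
    δUUV δUUW δUWW δVWW δUVW δWWW : X
    δUUV = cUUV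
    δUUW = cUUW
    δUWW = cUWW ⊕ ⊝ (cUUU ⊗ A)
    δVWW = cVWW
    δUVW = cUVW ⊕ num 3 ⊗ cUUU
    δWWW = cWWW ⊕ ⊝ (num 2 ⊗ B ⊗ cUUU)

    -- coefficients of the reduction on the diagonal points φ(P,P) = [2c : c² : 1]
    Xd Yd Zd : X
    Xd = ⊝ (num 4 ⊗ δUUV ⊗ A) ⊕ num 4 ⊗ δUUW ⊕ δVWW
    Yd = ⊝ (num 4 ⊗ δUUV ⊗ B) ⊕ ⊝ (num 2 ⊗ δUVW ⊗ A) ⊕ num 2 ⊗ δUWW
    Zd = δWWW ⊕ ⊝ (num 2 ⊗ δUVW ⊗ B)

    -- coefficients of the reduction on the points φ(P,Q) = [−c : c² + A : 1], P ≠ Q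
    Xo Yo Zo : X
    Xo = δUUW ⊕ δVWW
    Yo = ⊝ (δUUV ⊗ B) ⊕ ⊝ δUWW
    Zo = δUVW ⊗ B ⊕ δVWW ⊗ A ⊕ δWWW

    diagonalExcess offDiagonalExcess : X → X
    diagonalExcess c = cVVV ⊗ (c ⊗ c ⊗ c ⊗ c ⊗ c ⊗ c) ⊕ num 2 ⊗ cUVV ⊗ (c ⊗ c ⊗ c ⊗ c ⊗ c)
      ⊕ cVVW ⊗ (c ⊗ c ⊗ c ⊗ c)
      ⊕ (num 4 ⊗ δUUV ⊗ c ⊕ num 2 ⊗ δUVW ⊕ num 2 ⊗ cUUU) ⊗ weierstrass A B c
    offDiagonalExcess c = cVVV ⊗ ((c ⊗ c ⊕ A) ⊗ (c ⊗ c ⊕ A) ⊗ (c ⊗ c ⊕ A))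
      ⊕ cUVV ⊗ (⊝ c) ⊗ ((c ⊗ c ⊕ A) ⊗ (c ⊗ c ⊕ A)) ⊕ cVVW ⊗ ((c ⊗ c ⊕ A) ⊗ (c ⊗ c ⊕ A))
      ⊕ (δUUV ⊗ c ⊕ ⊝ δUVW ⊕ num 2 ⊗ cUUU) ⊗ weierstrass A B c

module Readings {c ℓ : Level} (R : CommutativeRing c ℓ) where
  open CommutativeRing R
  open IntegerCoefficients R

  ringSyntax : RingSyntax Carrier
  ringSyntax = record { _⊕_ = _+_ ; _⊗_ = _*_ ; ⊝_ = -_ ; num = nat }

  polynomialSyntax : (n : ℕ) → RingSyntax (Polynomial n)
  polynomialSyntax n = record { _⊕_ = _:+_ ; _⊗_ = _:*_ ; ⊝_ = :-_ ; num = λ k → con (+ k) }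

module FieldArithmetic {c ℓ : Level} (K : Field c ℓ) where
  open Field K
  open FieldTheory K using (CharacteristicZero)
  open IntegerCoefficients commutativeRing
  open import Algebra.Properties.Ring ring using (-0#≈0#; x∙y⁻¹≈ε⇒x≈y)
  open import Relation.Binary.Reasoning.Setoid setoid

  +-vanish : ∀ {a b} → a ≈ 0# → b ≈ 0# → a + b ≈ 0#
  +-vanish a≈0 b≈0 = trans (+-cong a≈0 b≈0) (+-identityˡ 0#)

  neg-vanish : ∀ {a} → a ≈ 0# → - a ≈ 0#
  neg-vanish a≈0 = trans (-‿cong a≈0) -0#≈0#

  sub-vanish : ∀ {a b} → a ≈ 0# → b ≈ 0# → a - b ≈ 0#
  sub-vanish a≈0 b≈0 = +-vanish a≈0 (neg-vanish b≈0)

  *-vanishˡ : ∀ {a b} → a ≈ 0# → a * b ≈ 0#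
  *-vanishˡ {b = b} a≈0 = trans (*-congʳ a≈0) (zeroˡ b)

  *-vanishʳ : ∀ {a b} → b ≈ 0# → a * b ≈ 0#
  *-vanishʳ {a} b≈0 = trans (*-congˡ b≈0) (zeroʳ a)

  vanishing-summand : ∀ {x y z} → x ≈ y + z → x ≈ 0# → y ≈ 0# → z ≈ 0#
  vanishing-summand {x} {y} {z} x≈y+z x≈0 y≈0 = begin
    z         ≈⟨ +-identityˡ z ⟨
    0# + z    ≈⟨ +-congʳ y≈0 ⟨
    y + z     ≈⟨ x≈y+z ⟨
    x         ≈⟨ x≈0 ⟩
    0#        ∎

  drop-vanishingˡ : ∀ {x y z} → x ≈ y + z → y ≈ 0# → x ≈ z
  drop-vanishingˡ {z = z} x≈y+z y≈0 = trans x≈y+z (trans (+-congʳ y≈0) (+-identityˡ z))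

  drop-vanishingʳ : ∀ {x y z} → x ≈ z + y → y ≈ 0# → x ≈ z
  drop-vanishingʳ {z = z} x≈z+y y≈0 = trans x≈z+y (trans (+-congˡ y≈0) (+-identityʳ z))

  cancel-nonzero : ∀ {x y} → ¬ (x ≈ 0#) → x * y ≈ 0# → y ≈ 0#
  cancel-nonzero {x} {y} x≉0 xy≈0 with inverse x x≉0
  ... | x⁻¹ , xx⁻¹≈1 = begin
    y               ≈⟨ *-identityˡ y ⟨
    1# * y          ≈⟨ *-congʳ xx⁻¹≈1 ⟨
    x * x⁻¹ * y     ≈⟨ solve 3 (λ x x⁻¹ y → x :* x⁻¹ :* y := x⁻¹ :* (x :* y)) refl x x⁻¹ y ⟩
    x⁻¹ * (x * y)   ≈⟨ *-vanishʳ xy≈0 ⟩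
    0#              ∎

  *-nonzero : ∀ {x y} → ¬ (x ≈ 0#) → ¬ (y ≈ 0#) → ¬ (x * y ≈ 0#)
  *-nonzero x≉0 y≉0 xy≈0 = y≉0 (cancel-nonzero x≉0 xy≈0)

  sub-nonzero : ∀ {a b} → ¬ (a ≈ b) → ¬ (a - b ≈ 0#)
  sub-nonzero {a} {b} a≉b a-b≈0 = a≉b (x∙y⁻¹≈ε⇒x≈y a b a-b≈0)

  nat-nonzero : CharacteristicZero → ∀ n → ¬ (nat (suc n) ≈ 0#)
  nat-nonzero char0 n n+1≈0 = char0 n (trans (sym (nat≈× (suc n))) n+1≈0)

  -- A polynomial x c² + y c + z of degree ≤ 2 with three distinct roots is
  -- zero: its divided differences x (a + b) + y and x vanish in turn.
  quadratic-three-roots : ∀ {x y z a₁ a₂ a₃} →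
    ¬ (a₁ ≈ a₂) → ¬ (a₁ ≈ a₃) → ¬ (a₂ ≈ a₃) →
    x * (a₁ * a₁) + y * a₁ + z ≈ 0# → x * (a₂ * a₂) + y * a₂ + z ≈ 0# →
    x * (a₃ * a₃) + y * a₃ + z ≈ 0# →
    x ≈ 0# × y ≈ 0# × z ≈ 0#
  quadratic-three-roots {x} {y} {z} {a₁} {a₂} {a₃} a₁≉a₂ a₁≉a₃ a₂≉a₃ q₁ q₂ q₃ = x≈0 , y≈0 , z≈0
    where
    first-difference : ∀ a b → (a - b) * (x * (a + b) + y)
      ≈ (x * (a * a) + y * a + z) - (x * (b * b) + y * b + z)
    first-difference = solve 5 (λ x y z a b →
      (a :- b) :* (x :* (a :+ b) :+ y) := (x :* (a :* a) :+ y :* a :+ z) :- (x :* (b :* b) :+ y :* b :+ z))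
      refl x y z
    second-difference : (a₂ - a₃) * x ≈ (x * (a₁ + a₂) + y) - (x * (a₁ + a₃) + y)
    second-difference = solve 5 (λ x y a₁ a₂ a₃ →
      (a₂ :- a₃) :* x := (x :* (a₁ :+ a₂) :+ y) :- (x :* (a₁ :+ a₃) :+ y)) refl x y a₁ a₂ a₃
    d₁₂ : x * (a₁ + a₂) + y ≈ 0#
    d₁₂ = cancel-nonzero (sub-nonzero a₁≉a₂) (trans (first-difference a₁ a₂) (sub-vanish q₁ q₂))
    d₁₃ : x * (a₁ + a₃) + y ≈ 0#
    d₁₃ = cancel-nonzero (sub-nonzero a₁≉a₃) (trans (first-difference a₁ a₃) (sub-vanish q₁ q₃))
    x≈0 : x ≈ 0#
    x≈0 = cancel-nonzero (sub-nonzero a₂≉a₃) (trans second-difference (sub-vanish d₁₂ d₁₃))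
    y≈0 : y ≈ 0#
    y≈0 = vanishing-summand refl d₁₂ (*-vanishˡ x≈0)
    z≈0 : z ≈ 0#
    z≈0 = vanishing-summand refl q₁ (+-vanish (*-vanishˡ x≈0) (*-vanishˡ y≈0))

module WeierstrassRoots {c ℓ : Level} (K : Field c ℓ) where
  open Field K
  open IntegerCoefficients commutativeRing
  open Readings commutativeRing
  open FieldArithmetic K
  open Expressions ringSyntax using (weierstrass; Δ)

  record DistinctRoots (A B a₁ a₂ a₃ : Carrier) : Set ℓ where
    field
      root₁ : weierstrass A B a₁ ≈ 0#
      root₂ : weierstrass A B a₂ ≈ 0#
      root₃ : weierstrass A B a₃ ≈ 0#
      a₁≉a₂ : ¬ (a₁ ≈ a₂)
      a₁≉a₃ : ¬ (a₁ ≈ a₃)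
      a₂≉a₃ : ¬ (a₂ ≈ a₃)

  -- cycling the roots, so that each of them can play the role of a₃
  rotate : ∀ {A B a₁ a₂ a₃} → DistinctRoots A B a₁ a₂ a₃ → DistinctRoots A B a₂ a₃ a₁
  rotate r = record
    { root₁ = root₂ ; root₂ = root₃ ; root₃ = root₁
    ; a₁≉a₂ = a₂≉a₃ ; a₁≉a₃ = λ a₂≈a₁ → a₁≉a₂ (sym a₂≈a₁) ; a₂≉a₃ = λ a₃≈a₁ → a₁≉a₃ (sym a₃≈a₁) }
    where open DistinctRoots r

  module Vieta {A B a₁ a₂ a₃ : Carrier} (roots : DistinctRoots A B a₁ a₂ a₃) where
    open DistinctRoots roots

    -- dividing f(a) − f(b) by a − b
    private
      difference-quotient : ∀ {a b} → ¬ (a ≈ b) → weierstrass A B a ≈ 0# → weierstrass A B b ≈ 0# →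
        a * a + a * b + b * b + A ≈ 0#
      difference-quotient {a} {b} a≉b fa≈0 fb≈0 = cancel-nonzero (sub-nonzero a≉b)
        (trans (solve 4 (λ a b A B → (a :- b) :* (a :* a :+ a :* b :+ b :* b :+ A)
                  := (a :* a :* a :+ A :* a :+ B) :- (b :* b :* b :+ A :* b :+ B)) refl a b A B)
               (sub-vanish fa≈0 fb≈0))

    sum-of-roots : a₁ + a₂ + a₃ ≈ 0#
    sum-of-roots = cancel-nonzero (sub-nonzero a₂≉a₃)
      (trans (solve 4 (λ a₁ a₂ a₃ A → (a₂ :- a₃) :* (a₁ :+ a₂ :+ a₃)
                := (a₁ :* a₁ :+ a₁ :* a₂ :+ a₂ :* a₂ :+ A) :- (a₁ :* a₁ :+ a₁ :* a₃ :+ a₃ :* a₃ :+ A))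
                refl a₁ a₂ a₃ A)
             (sub-vanish (difference-quotient a₁≉a₂ root₁ root₂) (difference-quotient a₁≉a₃ root₁ root₃)))

    pair-products : A - (a₁ * a₂ + a₁ * a₃ + a₂ * a₃) ≈ 0#
    pair-products = trans
      (solve 4 (λ a₁ a₂ a₃ A → A :- (a₁ :* a₂ :+ a₁ :* a₃ :+ a₂ :* a₃)
        := (a₁ :* a₁ :+ a₁ :* a₂ :+ a₂ :* a₂ :+ A) :- (a₁ :+ a₂) :* (a₁ :+ a₂ :+ a₃)) refl a₁ a₂ a₃ A)
      (sub-vanish (difference-quotient a₁≉a₂ root₁ root₂) (*-vanishʳ sum-of-roots))

    product-of-roots : B + a₁ * a₂ * a₃ ≈ 0#
    product-of-roots = trans
      (solve 5 (λ a₁ a₂ a₃ A B → B :+ a₁ :* a₂ :* a₃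
        := (a₁ :* a₁ :* a₁ :+ A :* a₁ :+ B) :- a₁ :* (A :- (a₁ :* a₂ :+ a₁ :* a₃ :+ a₂ :* a₃))
           :- a₁ :* a₁ :* (a₁ :+ a₂ :+ a₃)) refl a₁ a₂ a₃ A B)
      (sub-vanish (sub-vanish root₁ (*-vanishʳ pair-products)) (*-vanishʳ sum-of-roots))

    -- The sum and product of two roots in terms of the third: a₁ + a₂ = −a₃ and
    -- a₁a₂ = a₃² + A.  Hence φ(P₁,P₂) = [−a₃ : a₃² + A : 1].
    sum-of-first-two : a₁ + a₂ ≈ - a₃
    sum-of-first-two = drop-vanishingʳ
      (solve 3 (λ a₁ a₂ a₃ → a₁ :+ a₂ := :- a₃ :+ (a₁ :+ a₂ :+ a₃)) refl a₁ a₂ a₃)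
      sum-of-roots

    product-of-first-two : a₁ * a₂ ≈ a₃ * a₃ + A
    product-of-first-two = drop-vanishingʳ
      (solve 4 (λ a₁ a₂ a₃ A → a₁ :* a₂
        := (a₃ :* a₃ :+ A) :+ (:- (a₃ :* (a₁ :+ a₂ :+ a₃)) :+ :- (A :- (a₁ :* a₂ :+ a₁ :* a₃ :+ a₂ :* a₃))))
        refl a₁ a₂ a₃ A)
      (+-vanish (neg-vanish (*-vanishʳ sum-of-roots)) (neg-vanish pair-products))

    -- (a₁ − a₂)²(a₁ − a₃)²(a₂ − a₃)² = −Δ once Vieta's formulas hold, and the
    -- left side is nonzero since the roots are distinct
    discriminant-nonzero : ¬ (Δ A B ≈ 0#)
    discriminant-nonzero Δ≈0 = *-nonzero d≉0 d≉0 (trans (discriminant-identity a₁ a₂ a₃ A B)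
      (+-vanish (+-vanish (+-vanish (neg-vanish Δ≈0) (*-vanishˡ sum-of-roots))
        (*-vanishˡ pair-products)) (*-vanishˡ product-of-roots)))
      where
      d≉0 : ¬ ((a₁ - a₂) * (a₁ - a₃) * (a₂ - a₃) ≈ 0#)
      d≉0 = *-nonzero (*-nonzero (sub-nonzero a₁≉a₂) (sub-nonzero a₁≉a₃)) (sub-nonzero a₂≉a₃)
      discriminant-identity : ∀ a₁ a₂ a₃ A B →
        let e₁ = a₁ + a₂ + a₃ ; e₂ = a₁ * a₂ + a₁ * a₃ + a₂ * a₃ ; e₃ = a₁ * a₂ * a₃
            d = (a₁ - a₂) * (a₁ - a₃) * (a₂ - a₃) in
        d * d ≈ - Δ A B + e₁ * (e₁ * e₂ * e₂ - nat 4 * e₁ * e₁ * e₃ + nat 18 * e₂ * e₃)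
          + (A - e₂) * (nat 12 * e₂ * e₂ + nat 12 * e₂ * (A - e₂) + nat 4 * (A - e₂) * (A - e₂))
          + (B + e₃) * (nat 27 * (B + e₃) - nat 54 * e₃)
      discriminant-identity = solve 5 (λ a₁ a₂ a₃ A B →
        let e₁ = a₁ :+ a₂ :+ a₃ ; e₂ = a₁ :* a₂ :+ a₁ :* a₃ :+ a₂ :* a₃ ; e₃ = a₁ :* a₂ :* a₃
            d = (a₁ :- a₂) :* (a₁ :- a₃) :* (a₂ :- a₃)
            n : ℕ → Polynomial 5
            n k = con (+ k) in
        d :* d := :- (n 4 :* (A :* A :* A) :+ n 27 :* (B :* B))
          :+ e₁ :* (e₁ :* e₂ :* e₂ :- n 4 :* e₁ :* e₁ :* e₃ :+ n 18 :* e₂ :* e₃)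
          :+ (A :- e₂) :* (n 12 :* e₂ :* e₂ :+ n 12 :* e₂ :* (A :- e₂) :+ n 4 :* (A :- e₂) :* (A :- e₂))
          :+ (B :+ e₃) :* (n 27 :* (B :+ e₃) :- n 54 :* e₃)) refl

module PlaneCubics {c ℓ : Level} (K : Field c ℓ) where
  open Field K
  open import Algebra.Properties.Ring ring using (-‿involutive)
  open FieldTheory K
  open IntegerCoefficients commutativeRing
  open Readings commutativeRing
  open FieldArithmetic K

  eval-cong : ∀ (F : Cubic) {u u′ v v′} → u ≈ u′ → v ≈ v′ → eval F (pt u v 1#) ≈ eval F (pt u′ v′ 1#)
  eval-cong F u≈u′ v≈v′ =
    +-cong (+-cong (+-cong (+-cong (+-cong (+-cong (+-cong (+-cong (+-cong
      (*-congˡ (monomial u≈u′ u≈u′ u≈u′)) (*-congˡ (monomial v≈v′ v≈v′ v≈v′))) refl)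
      (*-congˡ (monomial u≈u′ u≈u′ v≈v′))) (*-congˡ (monomial u≈u′ u≈u′ refl)))
      (*-congˡ (monomial u≈u′ v≈v′ v≈v′))) (*-congˡ (monomial v≈v′ v≈v′ refl)))
      (*-congˡ (monomial u≈u′ refl refl))) (*-congˡ (monomial v≈v′ refl refl)))
      (*-congˡ (monomial u≈u′ v≈v′ refl))
    where
    monomial : ∀ {a a′ b b′ d d′} → a ≈ a′ → b ≈ b′ → d ≈ d′ → a * b * d ≈ a′ * b′ * d′
    monomial a≈a′ b≈b′ d≈d′ = *-cong (*-cong a≈a′ b≈b′) d≈d′

  -- The value, first and second partial derivatives of a cubic at [0:1:0]
  -- pick out single coefficients (the cubic is v³cVVV + v²(u cUVV + w cVVW) + …).
  module AtInfinity (F : Cubic) where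
    open Cubic F

    value-at-∞ : eval F φOO ≈ cVVV
    value-at-∞ = solve 10 (λ cUUU cVVV cWWW cUUV cUUW cUVV cVVW cUWW cVWW cUVW →
      let open Expressions (polynomialSyntax 10) in
      let open Form cUUU cVVV cWWW cUUV cUUW cUVV cVVW cUWW cVWW cUVW in
      value (num 0) (num 1) (num 0) := cVVV)
      refl cUUU cVVV cWWW cUUV cUUW cUVV cVVW cUWW cVWW cUVW

    ∂U-at-∞ : ∂U F φOO ≈ cUVV
    ∂U-at-∞ = solve 10 (λ cUUU cVVV cWWW cUUV cUUW cUVV cVVW cUWW cVWW cUVW →
      let open Expressions (polynomialSyntax 10) in
      let open Form cUUU cVVV cWWW cUUV cUUW cUVV cVVW cUWW cVWW cUVW in
      dU (num 0) (num 1) (num 0) := cUVV)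
      refl cUUU cVVV cWWW cUUV cUUW cUVV cVVW cUWW cVWW cUVW

    ∂V-at-∞ : ∂V F φOO ≈ 3# * cVVV
    ∂V-at-∞ = solve 10 (λ cUUU cVVV cWWW cUUV cUUW cUVV cVVW cUWW cVWW cUVW →
      let open Expressions (polynomialSyntax 10) in
      let open Form cUUU cVVV cWWW cUUV cUUW cUVV cVVW cUWW cVWW cUVW in
      dV (num 0) (num 1) (num 0) := num 3 :* cVVV)
      refl cUUU cVVV cWWW cUUV cUUW cUVV cVVW cUWW cVWW cUVW

    ∂W-at-∞ : ∂W F φOO ≈ cVVW
    ∂W-at-∞ = solve 10 (λ cUUU cVVV cWWW cUUV cUUW cUVV cVVW cUWW cVWW cUVW →
      let open Expressions (polynomialSyntax 10) in
      let open Form cUUU cVVV cWWW cUUV cUUW cUVV cVVW cUWW cVWW cUVW in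
      dW (num 0) (num 1) (num 0) := cVVW)
      refl cUUU cVVV cWWW cUUV cUUW cUVV cVVW cUWW cVWW cUVW

    ∂UU-at-∞ : ∂UU F φOO ≈ 2# * cUUV
    ∂UU-at-∞ = solve 10 (λ cUUU cVVV cWWW cUUV cUUW cUVV cVVW cUWW cVWW cUVW →
      let open Expressions (polynomialSyntax 10) in
      let open Form cUUU cVVV cWWW cUUV cUUW cUVV cVVW cUWW cVWW cUVW in
      dUU (num 0) (num 1) (num 0) := num 2 :* cUUV)
      refl cUUU cVVV cWWW cUUV cUUW cUVV cVVW cUWW cVWW cUVW

    ∂VV-at-∞ : ∂VV F φOO ≈ 6# * cVVV
    ∂VV-at-∞ = solve 10 (λ cUUU cVVV cWWW cUUV cUUW cUVV cVVW cUWW cVWW cUVW →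
      let open Expressions (polynomialSyntax 10) in
      let open Form cUUU cVVV cWWW cUUV cUUW cUVV cVVW cUWW cVWW cUVW in
      dVV (num 0) (num 1) (num 0) := (num 3 :+ num 3) :* cVVV)
      refl cUUU cVVV cWWW cUUV cUUW cUVV cVVW cUWW cVWW cUVW

    ∂WW-at-∞ : ∂WW F φOO ≈ 2# * cVWW
    ∂WW-at-∞ = solve 10 (λ cUUU cVVV cWWW cUUV cUUW cUVV cVVW cUWW cVWW cUVW →
      let open Expressions (polynomialSyntax 10) in
      let open Form cUUU cVVV cWWW cUUV cUUW cUVV cVVW cUWW cVWW cUVW in
      dWW (num 0) (num 1) (num 0) := num 2 :* cVWW)
      refl cUUU cVVV cWWW cUUV cUUW cUVV cVVW cUWW cVWW cUVW

    ∂UV-at-∞ : ∂UV F φOO ≈ 2# * cUVV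
    ∂UV-at-∞ = solve 10 (λ cUUU cVVV cWWW cUUV cUUW cUVV cVVW cUWW cVWW cUVW →
      let open Expressions (polynomialSyntax 10) in
      let open Form cUUU cVVV cWWW cUUV cUUW cUVV cVVW cUWW cVWW cUVW in
      dUV (num 0) (num 1) (num 0) := num 2 :* cUVV)
      refl cUUU cVVV cWWW cUUV cUUW cUVV cVVW cUWW cVWW cUVW

    ∂UW-at-∞ : ∂UW F φOO ≈ cUVW
    ∂UW-at-∞ = solve 10 (λ cUUU cVVV cWWW cUUV cUUW cUVV cVVW cUWW cVWW cUVW →
      let open Expressions (polynomialSyntax 10) in
      let open Form cUUU cVVV cWWW cUUV cUUW cUVV cVVW cUWW cVWW cUVW in
      dUW (num 0) (num 1) (num 0) := cUVW)
      refl cUUU cVVV cWWW cUUV cUUW cUVV cVVW cUWW cVWW cUVW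

    ∂VW-at-∞ : ∂VW F φOO ≈ 2# * cVVW
    ∂VW-at-∞ = solve 10 (λ cUUU cVVV cWWW cUUV cUUW cUVV cVVW cUWW cVWW cUVW →
      let open Expressions (polynomialSyntax 10) in
      let open Form cUUU cVVV cWWW cUUV cUUW cUVV cVVW cUWW cVWW cUVW in
      dVW (num 0) (num 1) (num 0) := num 2 :* cVVW)
      refl cUUU cVVV cWWW cUUV cUUW cUVV cVVW cUWW cVWW cUVW

  double-point-coefficients : ∀ F → IsDoublePoint F φOO →
    Cubic.cVVV F ≈ 0# × Cubic.cUVV F ≈ 0# × Cubic.cVVW F ≈ 0#
  double-point-coefficients F (F≈0 , ∂U≈0 , _ , ∂W≈0 , _) =
    trans (sym value-at-∞) F≈0 , trans (sym ∂U-at-∞) ∂U≈0 , trans (sym ∂W-at-∞) ∂W≈0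
    where open AtInfinity F

  -- A double point needs some nonzero second derivative, which a zero
  -- multiple t · G (t ≈ 0) does not have; so a cubic with a double point at
  -- [0:1:0] is only a nonzero multiple of another one.
  scalar-nonzero : ∀ {F G t} → IsDoublePoint F φOO → F ≈ t · G → ¬ (t ≈ 0#)
  scalar-nonzero {F} {G} {t} (_ , _ , _ , _ , some-second-derivative)
    (_ , eVVV , _ , eUUV , _ , eUVV , eVVW , _ , eVWW , eUVW) t≈0 =
    some-second-derivative
      ( trans ∂UU-at-∞ (*-vanishʳ (vanishes eUUV)) , trans ∂VV-at-∞ (*-vanishʳ (vanishes eVVV))
      , trans ∂WW-at-∞ (*-vanishʳ (vanishes eVWW)) , trans ∂UV-at-∞ (*-vanishʳ (vanishes eUVV))
      , trans ∂UW-at-∞ (vanishes eUVW) , trans ∂VW-at-∞ (*-vanishʳ (vanishes eVVW)))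
    where
    open AtInfinity F
    vanishes : ∀ {x g} → x ≈ t * g → x ≈ 0#
    vanishes x≈tg = trans x≈tg (*-vanishˡ t≈0)

  -- C_E has a double point at [0:1:0]: its tangent cone there is −3UW ≠ 0
  C-E-double-point : ∀ A B → ¬ (3# ≈ 0#) → IsDoublePoint (C-E A B) φOO
  C-E-double-point A B 3≉0 = value-at-∞ , ∂U-at-∞ , trans ∂V-at-∞ (zeroʳ 3#) , ∂W-at-∞ ,
    λ { (_ , _ , _ , _ , ∂UW≈0 , _) → 3≉0 (trans (sym (-‿involutive 3#)) (neg-vanish (trans (sym ∂UW-at-∞) ∂UW≈0))) }
    where open AtInfinity (C-E A B)

  -- C_E(φ(a,b)) = f(a) + f(b) for f(x) = x³ + Ax + B, so C_E passes through
  -- φ(P,Q) for all 2-torsion points P, Q ≠ O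
  C-E-through : ∀ {A B a b} → let open Expressions ringSyntax in
    weierstrass A B a ≈ 0# → weierstrass A B b ≈ 0# → OnCurve (C-E A B) (φ a b)
  C-E-through {A} {B} {a} {b} fa≈0 fb≈0 = trans
    (solve 4 (λ A B a b →
      let open Expressions (polynomialSyntax 4) in
      let open Form (num 1) (num 0) (num 2 ⊗ B) (num 0) (num 0) (num 0) (num 0) A (num 0) (⊝ num 3) in
      value (a ⊕ b) (a ⊗ b) (num 1) := weierstrass A B a ⊕ weierstrass A B b) refl A B a b)
    (+-vanish fa≈0 fb≈0)

module ReductionIdentities {c ℓ : Level} (K : Field c ℓ) where
  open Field K
  open IntegerCoefficients commutativeRing
  open Readings commutativeRing

  diagonal-reduction : ∀ cUUU cVVV cWWW cUUV cUUW cUVV cVVW cUWW cVWW cUVW A B c →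
    let open Expressions ringSyntax in let open Reduction cUUU cVVV cWWW cUUV cUUW cUVV cVVW cUWW cVWW cUVW A B in
    value (c ⊕ c) (c ⊗ c) (num 1) ≈ diagonalExcess c ⊕ quadratic Xd Yd Zd c
  diagonal-reduction = solve 13 (λ cUUU cVVV cWWW cUUV cUUW cUVV cVVW cUWW cVWW cUVW A B c →
    let open Expressions (polynomialSyntax 13) in let open Reduction cUUU cVVV cWWW cUUV cUUW cUVV cVVW cUWW cVWW cUVW A B in
    value (c ⊕ c) (c ⊗ c) (num 1) := diagonalExcess c ⊕ quadratic Xd Yd Zd c) refl

  off-diagonal-reduction : ∀ cUUU cVVV cWWW cUUV cUUW cUVV cVVW cUWW cVWW cUVW A B c →
    let open Expressions ringSyntax in let open Reduction cUUU cVVV cWWW cUUV cUUW cUVV cVVW cUWW cVWW cUVW A B in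
    value (⊝ c) (c ⊗ c ⊕ A) (num 1) ≈ offDiagonalExcess c ⊕ quadratic Xo Yo Zo c
  off-diagonal-reduction = solve 13 (λ cUUU cVVV cWWW cUUV cUUW cUVV cVVW cUWW cVWW cUVW A B c →
    let open Expressions (polynomialSyntax 13) in let open Reduction cUUU cVVV cWWW cUUV cUUW cUVV cVVW cUWW cVWW cUVW A B in
    value (⊝ c) (c ⊗ c ⊕ A) (num 1) := offDiagonalExcess c ⊕ quadratic Xo Yo Zo c) refl

  -- Cramer's rule for the linear system Xd = Yd = Zd = Xo = Yo = Zo = 0 in
  -- the unknowns δ: its determinant is a multiple of 2 · 3 · Δ(A,B).
  eliminate-δUVW : ∀ cUUU cVVV cWWW cUUV cUUW cUVV cVVW cUWW cVWW cUVW A B →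
    let open Expressions ringSyntax in let open Reduction cUUU cVVV cWWW cUUV cUUW cUVV cVVW cUWW cVWW cUVW A B in
    num 2 ⊗ Δ A B ⊗ δUVW ≈ num 4 ⊗ (A ⊗ A) ⊗ ⊝ (Yd ⊕ num 2 ⊗ Yo) ⊕ num 6 ⊗ B ⊗ (num 3 ⊗ (Zo ⊖ Zd ⊖ A ⊗ Xo) ⊕ A ⊗ (Xd ⊖ Xo))
  eliminate-δUVW = solve 12 (λ cUUU cVVV cWWW cUUV cUUW cUVV cVVW cUWW cVWW cUVW A B →
    let open Expressions (polynomialSyntax 12) in let open Reduction cUUU cVVV cWWW cUUV cUUW cUVV cVVW cUWW cVWW cUVW A B in
    num 2 ⊗ Δ A B ⊗ δUVW := num 4 ⊗ (A ⊗ A) ⊗ ⊝ (Yd ⊕ num 2 ⊗ Yo) ⊕ num 6 ⊗ B ⊗ (num 3 ⊗ (Zo ⊖ Zd ⊖ A ⊗ Xo) ⊕ A ⊗ (Xd ⊖ Xo))) refl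

  eliminate-δUUV : ∀ cUUU cVVV cWWW cUUV cUUW cUVV cVVW cUWW cVWW cUVW A B →
    let open Expressions ringSyntax in let open Reduction cUUU cVVV cWWW cUUV cUUW cUVV cVVW cUWW cVWW cUVW A B in
    num 2 ⊗ Δ A B ⊗ δUUV ≈ num 9 ⊗ B ⊗ ⊝ (Yd ⊕ num 2 ⊗ Yo) ⊖ num 2 ⊗ A ⊗ (num 3 ⊗ (Zo ⊖ Zd ⊖ A ⊗ Xo) ⊕ A ⊗ (Xd ⊖ Xo))
  eliminate-δUUV = solve 12 (λ cUUU cVVV cWWW cUUV cUUW cUVV cVVW cUWW cVWW cUVW A B →
    let open Expressions (polynomialSyntax 12) in let open Reduction cUUU cVVV cWWW cUUV cUUW cUVV cVVW cUWW cVWW cUVW A B in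
    num 2 ⊗ Δ A B ⊗ δUUV := num 9 ⊗ B ⊗ ⊝ (Yd ⊕ num 2 ⊗ Yo) ⊖ num 2 ⊗ A ⊗ (num 3 ⊗ (Zo ⊖ Zd ⊖ A ⊗ Xo) ⊕ A ⊗ (Xd ⊖ Xo))) refl

  eliminate-δUUW : ∀ cUUU cVVV cWWW cUUV cUUW cUVV cVVW cUWW cVWW cUVW A B →
    let open Expressions ringSyntax in let open Reduction cUUU cVVV cWWW cUUV cUUW cUVV cVVW cUWW cVWW cUVW A B in
    num 3 ⊗ δUUW ≈ (Xd ⊖ Xo) ⊕ num 4 ⊗ δUUV ⊗ A
  eliminate-δUUW = solve 12 (λ cUUU cVVV cWWW cUUV cUUW cUVV cVVW cUWW cVWW cUVW A B →
    let open Expressions (polynomialSyntax 12) in let open Reduction cUUU cVVV cWWW cUUV cUUW cUVV cVVW cUWW cVWW cUVW A B in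
    num 3 ⊗ δUUW := (Xd ⊖ Xo) ⊕ num 4 ⊗ δUUV ⊗ A) refl

  eliminate-δVWW : ∀ cUUU cVVV cWWW cUUV cUUW cUVV cVVW cUWW cVWW cUVW A B →
    let open Expressions ringSyntax in let open Reduction cUUU cVVV cWWW cUUV cUUW cUVV cVVW cUWW cVWW cUVW A B in
    δVWW ≈ Xo ⊕ ⊝ δUUW
  eliminate-δVWW = solve 12 (λ cUUU cVVV cWWW cUUV cUUW cUVV cVVW cUWW cVWW cUVW A B →
    let open Expressions (polynomialSyntax 12) in let open Reduction cUUU cVVV cWWW cUUV cUUW cUVV cVVW cUWW cVWW cUVW A B in
    δVWW := Xo ⊕ ⊝ δUUW) refl

  eliminate-δUWW : ∀ cUUU cVVV cWWW cUUV cUUW cUVV cVVW cUWW cVWW cUVW A B →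
    let open Expressions ringSyntax in let open Reduction cUUU cVVV cWWW cUUV cUUW cUVV cVVW cUWW cVWW cUVW A B in
    δUWW ≈ ⊝ Yo ⊕ ⊝ (δUUV ⊗ B)
  eliminate-δUWW = solve 12 (λ cUUU cVVV cWWW cUUV cUUW cUVV cVVW cUWW cVWW cUVW A B →
    let open Expressions (polynomialSyntax 12) in let open Reduction cUUU cVVV cWWW cUUV cUUW cUVV cVVW cUWW cVWW cUVW A B in
    δUWW := ⊝ Yo ⊕ ⊝ (δUUV ⊗ B)) refl

  eliminate-δWWW : ∀ cUUU cVVV cWWW cUUV cUUW cUVV cVVW cUWW cVWW cUVW A B →
    let open Expressions ringSyntax in let open Reduction cUUU cVVV cWWW cUUV cUUW cUVV cVVW cUWW cVWW cUVW A B in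
    δWWW ≈ Zd ⊕ num 2 ⊗ δUVW ⊗ B
  eliminate-δWWW = solve 12 (λ cUUU cVVV cWWW cUUV cUUW cUVV cVVW cUWW cVWW cUVW A B →
    let open Expressions (polynomialSyntax 12) in let open Reduction cUUU cVVV cWWW cUUV cUUW cUVV cVVW cUWW cVWW cUVW A B in
    δWWW := Zd ⊕ num 2 ⊗ δUVW ⊗ B) refl

  coefficient-WWW : ∀ cUUU cVVV cWWW cUUV cUUW cUVV cVVW cUWW cVWW cUVW A B →
    let open Expressions ringSyntax in let open Reduction cUUU cVVV cWWW cUUV cUUW cUVV cVVW cUWW cVWW cUVW A B in
    cWWW ≈ δWWW ⊕ cUUU ⊗ (num 2 ⊗ B)
  coefficient-WWW = solve 12 (λ cUUU cVVV cWWW cUUV cUUW cUVV cVVW cUWW cVWW cUVW A B →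
    let open Expressions (polynomialSyntax 12) in let open Reduction cUUU cVVV cWWW cUUV cUUW cUVV cVVW cUWW cVWW cUVW A B in
    cWWW := δWWW ⊕ cUUU ⊗ (num 2 ⊗ B)) refl

  coefficient-UWW : ∀ cUUU cVVV cWWW cUUV cUUW cUVV cVVW cUWW cVWW cUVW A B →
    let open Expressions ringSyntax in let open Reduction cUUU cVVV cWWW cUUV cUUW cUVV cVVW cUWW cVWW cUVW A B in
    cUWW ≈ δUWW ⊕ cUUU ⊗ A
  coefficient-UWW = solve 12 (λ cUUU cVVV cWWW cUUV cUUW cUVV cVVW cUWW cVWW cUVW A B →
    let open Expressions (polynomialSyntax 12) in let open Reduction cUUU cVVV cWWW cUUV cUUW cUVV cVVW cUWW cVWW cUVW A B in
    cUWW := δUWW ⊕ cUUU ⊗ A) refl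

  coefficient-UVW : ∀ cUUU cVVV cWWW cUUV cUUW cUVV cVVW cUWW cVWW cUVW A B →
    let open Expressions ringSyntax in let open Reduction cUUU cVVV cWWW cUUV cUUW cUVV cVVW cUWW cVWW cUVW A B in
    cUVW ≈ δUVW ⊕ cUUU ⊗ ⊝ num 3
  coefficient-UVW = solve 12 (λ cUUU cVVV cWWW cUUV cUUW cUVV cVVW cUWW cVWW cUVW A B →
    let open Expressions (polynomialSyntax 12) in let open Reduction cUUU cVVV cWWW cUUV cUUW cUVV cVVW cUWW cVWW cUVW A B in
    cUVW := δUVW ⊕ cUUU ⊗ ⊝ num 3) refl

module Uniqueness {c ℓ : Level} (K : Field c ℓ) (F : FieldTheory.Cubic K) (A B : Field.Carrier K) where
  open Field K
  open FieldTheory K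
  open Cubic F
  open Readings commutativeRing
  open FieldArithmetic K
  open WeierstrassRoots K
  open PlaneCubics K using (eval-cong; double-point-coefficients)
  open ReductionIdentities K
  open Expressions ringSyntax using (weierstrass; quadratic; Δ; module Reduction)
  open Reduction cUUU cVVV cWWW cUUV cUUW cUVV cVVW cUWW cVWW cUVW A B

  δ-vanish : ¬ (2# ≈ 0#) → ¬ (3# ≈ 0#) → ¬ (Δ A B ≈ 0#) →
    Xd ≈ 0# × Yd ≈ 0# × Zd ≈ 0# → Xo ≈ 0# × Yo ≈ 0# × Zo ≈ 0# →
    δUUV ≈ 0# × δUUW ≈ 0# × δUWW ≈ 0# × δVWW ≈ 0# × δUVW ≈ 0# × δWWW ≈ 0#
  δ-vanish 2≉0 3≉0 Δ≉0 (Xd≈0 , Yd≈0 , Zd≈0) (Xo≈0 , Yo≈0 , Zo≈0) =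
    δUUV≈0 , δUUW≈0 , δUWW≈0 , δVWW≈0 , δUVW≈0 , δWWW≈0
    where
    combination₁ : - (Yd + 2# * Yo) ≈ 0#
    combination₁ = neg-vanish (+-vanish Yd≈0 (*-vanishʳ Yo≈0))
    combination₂ : 3# * (Zo - Zd - A * Xo) + A * (Xd - Xo) ≈ 0#
    combination₂ = +-vanish (*-vanishʳ (sub-vanish (sub-vanish Zo≈0 Zd≈0) (*-vanishʳ Xo≈0)))
      (*-vanishʳ (sub-vanish Xd≈0 Xo≈0))
    δUVW≈0 : δUVW ≈ 0#
    δUVW≈0 = cancel-nonzero (*-nonzero 2≉0 Δ≉0)
      (trans (eliminate-δUVW cUUU cVVV cWWW cUUV cUUW cUVV cVVW cUWW cVWW cUVW A B)
        (+-vanish (*-vanishʳ combination₁) (*-vanishʳ combination₂)))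
    δUUV≈0 : δUUV ≈ 0#
    δUUV≈0 = cancel-nonzero (*-nonzero 2≉0 Δ≉0)
      (trans (eliminate-δUUV cUUU cVVV cWWW cUUV cUUW cUVV cVVW cUWW cVWW cUVW A B)
        (sub-vanish (*-vanishʳ combination₁) (*-vanishʳ combination₂)))
    δUUW≈0 : δUUW ≈ 0#
    δUUW≈0 = cancel-nonzero 3≉0
      (trans (eliminate-δUUW cUUU cVVV cWWW cUUV cUUW cUVV cVVW cUWW cVWW cUVW A B)
        (+-vanish (sub-vanish Xd≈0 Xo≈0) (*-vanishˡ (*-vanishʳ δUUV≈0))))
    δVWW≈0 : δVWW ≈ 0#
    δVWW≈0 = trans (eliminate-δVWW cUUU cVVV cWWW cUUV cUUW cUVV cVVW cUWW cVWW cUVW A B)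
      (sub-vanish Xo≈0 δUUW≈0)
    δUWW≈0 : δUWW ≈ 0#
    δUWW≈0 = trans (eliminate-δUWW cUUU cVVV cWWW cUUV cUUW cUVV cVVW cUWW cVWW cUVW A B)
      (+-vanish (neg-vanish Yo≈0) (neg-vanish (*-vanishˡ δUUV≈0)))
    δWWW≈0 : δWWW ≈ 0#
    δWWW≈0 = trans (eliminate-δWWW cUUU cVVV cWWW cUUV cUUW cUVV cVVW cUWW cVWW cUVW A B)
      (+-vanish Zd≈0 (*-vanishˡ (*-vanishʳ δUVW≈0)))

  module _ (double : IsDoublePoint F φOO) where
    cVVV≈0 : cVVV ≈ 0#
    cVVV≈0 = proj₁ (double-point-coefficients F double)
    cUVV≈0 : cUVV ≈ 0#
    cUVV≈0 = proj₁ (proj₂ (double-point-coefficients F double))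
    cVVW≈0 : cVVW ≈ 0#
    cVVW≈0 = proj₂ (proj₂ (double-point-coefficients F double))

    diagonal-condition : ∀ {c} → weierstrass A B c ≈ 0# → eval F (φ c c) ≈ 0# →
      quadratic Xd Yd Zd c ≈ 0#
    diagonal-condition {c} fc≈0 F≈0 = vanishing-summand
      (diagonal-reduction cUUU cVVV cWWW cUUV cUUW cUVV cVVW cUWW cVWW cUVW A B c) F≈0
      (+-vanish (+-vanish (+-vanish (*-vanishˡ cVVV≈0) (*-vanishˡ (*-vanishʳ cUVV≈0)))
        (*-vanishˡ cVVW≈0)) (*-vanishʳ fc≈0))

    off-diagonal-condition : ∀ {c} → weierstrass A B c ≈ 0# → eval F (pt (- c) (c * c + A) 1#) ≈ 0# →
      quadratic Xo Yo Zo c ≈ 0#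
    off-diagonal-condition {c} fc≈0 F≈0 = vanishing-summand
      (off-diagonal-reduction cUUU cVVV cWWW cUUV cUUW cUVV cVVW cUWW cVWW cUVW A B c) F≈0
      (+-vanish (+-vanish (+-vanish (*-vanishˡ cVVV≈0) (*-vanishˡ (*-vanishˡ cUVV≈0)))
        (*-vanishˡ cVVW≈0)) (*-vanishʳ fc≈0))

    proportional : δUUV ≈ 0# × δUUW ≈ 0# × δUWW ≈ 0# × δVWW ≈ 0# × δUVW ≈ 0# × δWWW ≈ 0# →
      F ≈ cUUU · C-E A B
    proportional (δUUV≈0 , δUUW≈0 , δUWW≈0 , δVWW≈0 , δUVW≈0 , δWWW≈0) =
        sym (*-identityʳ cUUU) , by-zero cVVV≈0
      , drop-vanishingˡ (coefficient-WWW cUUU cVVV cWWW cUUV cUUW cUVV cVVW cUWW cVWW cUVW A B) δWWW≈0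
      , by-zero δUUV≈0 , by-zero δUUW≈0 , by-zero cUVV≈0 , by-zero cVVW≈0
      , drop-vanishingˡ (coefficient-UWW cUUU cVVV cWWW cUUV cUUW cUVV cVVW cUWW cVWW cUVW A B) δUWW≈0
      , by-zero δVWW≈0
      , drop-vanishingˡ (coefficient-UVW cUUU cVVV cWWW cUUV cUUW cUVV cVVW cUWW cVWW cUVW A B) δUVW≈0
      where
      by-zero : ∀ {x} → x ≈ 0# → x ≈ cUUU * 0#
      by-zero x≈0 = trans x≈0 (sym (zeroʳ cUUU))

    -- The conditions at φ(aᵢ,aᵢ) and at φ(aᵢ,aᵢ₊₁) = [−aᵢ₊₂ : aᵢ₊₂² + A : 1]
    -- give two quadratics with the three roots a₁, a₂, a₃, so all of Xd … Zo
    -- vanish, and then F = cUUU · C_E.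
    multiple-of-C-E : ¬ (2# ≈ 0#) → ¬ (3# ≈ 0#) → ∀ {a₁ a₂ a₃} → DistinctRoots A B a₁ a₂ a₃ →
      eval F (φ a₁ a₁) ≈ 0# → eval F (φ a₂ a₂) ≈ 0# → eval F (φ a₃ a₃) ≈ 0# →
      eval F (φ a₁ a₂) ≈ 0# → eval F (φ a₂ a₃) ≈ 0# → eval F (φ a₃ a₁) ≈ 0# →
      F ≈ cUUU · C-E A B
    multiple-of-C-E 2≉0 3≉0 roots on₁₁ on₂₂ on₃₃ on₁₂ on₂₃ on₃₁ =
      proportional (δ-vanish 2≉0 3≉0 (Vieta.discriminant-nonzero roots) diagonal off-diagonal)
      where
      open DistinctRoots roots
      at-third-root : ∀ {x y z} → DistinctRoots A B x y z → eval F (φ x y) ≈ 0# →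
        eval F (pt (- z) (z * z + A) 1#) ≈ 0#
      at-third-root r on = trans
        (eval-cong F (sym (Vieta.sum-of-first-two r)) (sym (Vieta.product-of-first-two r))) on
      diagonal : Xd ≈ 0# × Yd ≈ 0# × Zd ≈ 0#
      diagonal = quadratic-three-roots a₁≉a₂ a₁≉a₃ a₂≉a₃
        (diagonal-condition root₁ on₁₁) (diagonal-condition root₂ on₂₂) (diagonal-condition root₃ on₃₃)
      off-diagonal : Xo ≈ 0# × Yo ≈ 0# × Zo ≈ 0#
      off-diagonal = quadratic-three-roots a₁≉a₂ a₁≉a₃ a₂≉a₃
        (off-diagonal-condition root₁ (at-third-root (rotate roots) on₂₃))
        (off-diagonal-condition root₂ (at-third-root (rotate (rotate roots)) on₃₁))
        (off-diagonal-condition root₃ (at-third-root roots on₁₂))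

lemma4p6 : ∀ {c ℓ : Level} (K : Field c ℓ) →
    let open Field K in let open FieldTheory K in
    CharacteristicZero →
    (A B : Carrier) (α : Fin 3 → Carrier) → Is2TorsionData A B α →
    (IsDoublePoint (C-E A B) φOO × (∀ i j → OnCurve (C-E A B) (φ (α i) (α j))))
    × (∀ (F : Cubic) → IsDoublePoint F φOO → (∀ i j → OnCurve F (φ (α i) (α j))) →
    Σ Carrier (λ t → ¬ (t ≈ 0#) × F ≈ t · C-E A B))
lemma4p6 K char0 A B α (roots , distinct) =
    (C-E-double-point A B 3≉0 , λ i j → C-E-through (roots i) (roots j))
  , λ F double on → Cubic.cUUU F , scalar-nonzero double (multiple F double on) , multiple F double on
  where
  open Field K hiding (zero)
  open FieldTheory K
  open FieldArithmetic K using (nat-nonzero)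
  open WeierstrassRoots K using (DistinctRoots)
  open PlaneCubics K using (C-E-double-point; C-E-through; scalar-nonzero)

  2≉0 : ¬ (2# ≈ 0#)
  2≉0 = nat-nonzero char0 1
  3≉0 : ¬ (3# ≈ 0#)
  3≉0 = nat-nonzero char0 2

  i₁ i₂ i₃ : Fin 3
  i₁ = zero
  i₂ = suc zero
  i₃ = suc (suc zero)

  distinct-roots : DistinctRoots A B (α i₁) (α i₂) (α i₃)
  distinct-roots = record
    { root₁ = roots i₁ ; root₂ = roots i₂ ; root₃ = roots i₃
    ; a₁≉a₂ = distinct i₁ i₂ (λ ()) ; a₁≉a₃ = distinct i₁ i₃ (λ ()) ; a₂≉a₃ = distinct i₂ i₃ (λ ()) }

  -- the six points φ(αᵢ,αᵢ) and φ(αᵢ,αᵢ₊₁) already force F = cUUU · C_E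
  multiple : ∀ F → IsDoublePoint F φOO → (∀ i j → OnCurve F (φ (α i) (α j))) →
    F ≈ Cubic.cUUU F · C-E A B
  multiple F double on = Uniqueness.multiple-of-C-E K F A B double 2≉0 3≉0 distinct-roots
    (on i₁ i₁) (on i₂ i₂) (on i₃ i₃) (on i₁ i₂) (on i₂ i₃) (on i₃ i₁)
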